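{- Let $T(n)=\sum_{k=0}^{n}\left[\binom{6k}{n+3k}\binom{n}{k}\bmod 2\right]$ for $n\ge 0$. Let $(S(n))_{n\ge0}$ be the sequence alternating between $1$ and the positive integers, i.e. $S(2j)=1$ and $S(2j+1)=j+1$ for $j\ge0$ ($1,1,1,2,1,3,1,4,\dots$; equivalently $S(0)=S(1)=S(2)=1$, $S(3)=2$, $S(n)=2S(n-2)-S(n-4)$ for $n\ge4$). Then $T$ is the run length transform of $S$.
   Context: For integers $a$ and $b\ge0$, $\binom{a}{b}=0$ whenever $a<b$. $[x \bmod 2]$ denotes the residue in $\{0,1\}$. The run length transform of a sequence $(S(n))_{n\ge0}$ is $T(n)=\prod_{i\in\mathcal{L}(n)}S(i)$, where $\mathcal{L}(n)$ is the multiset of lengths of all maximal runs of $1$'s in the binary representation of $n$ (so $T(0)=1$). -}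

module Defs where

open import Data.Nat using (ℕ; zero; suc; _+_; _*_)
open import Data.Nat.DivMod using (_/_; _%_)
open import Data.Nat.Combinatorics using (_C_)
open import Data.List using (List; []; _∷_; map; upTo)
open import Data.Nat.ListAction using (sum; product)

-- Binary digits of n, least significant first (empty list for n = 0).
-- The first argument is fuel; fuel n suffices for n since n / 2 < n.
bitsAux : ℕ → ℕ → List ℕ
bitsAux zero    _ = []
bitsAux (suc f) zero = []
bitsAux (suc f) n@(suc _) = (n % 2) ∷ bitsAux f (n / 2)

bits : ℕ → List ℕ
bits n = bitsAux n n

runsAux : ℕ → List ℕ → List ℕ
runsAux zero    []           = []
runsAux (suc c) []           = suc c ∷ []
runsAux c       (1 ∷ ds)     = runsAux (suc c) ds
runsAux zero    (_ ∷ ds)     = runsAux zero ds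
runsAux (suc c) (_ ∷ ds)     = suc c ∷ runsAux zero ds

runLengths : ℕ → List ℕ
runLengths n = runsAux zero (bits n)

runLengthTransform : (ℕ → ℕ) → ℕ → ℕ
runLengthTransform S n = product (map S (runLengths n))

S : ℕ → ℕ
S zero = 1
S (suc zero) = 1
S (suc (suc n)) = S n + (n % 2)

T : ℕ → ℕ
T n = sum (map (λ k → (((6 * k) C (n + 3 * k)) * (n C k)) % 2) (upTo (suc n)))

-- Lucas' theorem modulo 2 lets one strip the lowest binary digits of n and k at once.
-- Generalising the summand to C(6k + p, n + 3k + q) C(n, k), with offsets p, q holding
-- the carries, the sum for n becomes a 0/1-weighted sum of the same sums for ⌊n/2⌋ at
-- new offsets. From (p, q) = (0, 0) only six offset pairs are reachable, so T is computed
-- by a six-state automaton reading the binary digits of n; following it along a run of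
-- l ones and the 0 that closes it multiplies the value by S(l).
module Submission where

open import Data.List using (List; []; _∷_; map; applyUpTo)
open import Data.Nat
open import Data.Nat.Combinatorics using (_C_; nCk+nC[k+1]≡[n+1]C[k+1]; k>n⇒nCk≡0)
open import Data.Nat.DivMod
open import Data.Nat.ListAction using (sum; product)
open import Data.Nat.Properties
open import Data.Nat.Tactic.RingSolver using (solve-∀)
open import Algebra.Properties.CommutativeSemigroup +-commutativeSemigroup using (interchange)
open import Function using (_∘_)
open import Relation.Binary.PropositionalEquality

open import Defs

double : ℕ → ℕ
double zero    = zero
double (suc n) = suc (suc (double n))

double≡2* : ∀ n → double n ≡ 2 * n
double≡2* zero    = refl
double≡2* (suc n) = trans (cong (suc ∘ suc) (double≡2* n)) (sym (*-suc 2 n))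

double-distrib-+ : ∀ m n → double (m + n) ≡ double m + double n
double-distrib-+ zero    n = refl
double-distrib-+ (suc m) n = cong (suc ∘ suc) (double-distrib-+ m n)

n≡double[n/2]+n%2 : ∀ n → n ≡ double (n / 2) + n % 2
n≡double[n/2]+n%2 n = begin
  n                     ≡⟨ m≡m%n+[m/n]*n n 2 ⟩
  n % 2 + n / 2 * 2     ≡⟨ +-comm (n % 2) _ ⟩
  n / 2 * 2 + n % 2     ≡⟨ cong (_+ n % 2) (*-comm (n / 2) 2) ⟩
  2 * (n / 2) + n % 2   ≡⟨ cong (_+ n % 2) (double≡2* (n / 2)) ⟨
  double (n / 2) + n % 2 ∎
  where open ≡-Reasoning

double%2≡0 : ∀ n → double n % 2 ≡ 0
double%2≡0 n = trans (cong (_% 2) (trans (double≡2* n) (*-comm 2 n))) (m*n%n≡0 n 2)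

[n+n]%2≡0 : ∀ n → (n + n) % 2 ≡ 0
[n+n]%2≡0 n = trans (cong (_% 2) (sym (trans (double≡2* n) (cong (n +_) (+-identityʳ n)))))
                    (double%2≡0 n)

bit*bit<2 : ∀ {a b} → a < 2 → b < 2 → a * b < 2
bit*bit<2 {zero}          _         _   = s≤s z≤n
bit*bit<2 {suc zero}      _         b<2 = subst (_< 2) (sym (+-identityʳ _)) b<2
bit*bit<2 {suc (suc _)} (s≤s (s≤s ())) _

[m*n]%2≡m%2*n%2 : ∀ m n → (m * n) % 2 ≡ (m % 2) * (n % 2)
[m*n]%2≡m%2*n%2 m n =
  trans (%-distribˡ-* m n 2) (m<n⇒m%n≡m (bit*bit<2 (m%n<n m 2) (m%n<n n 2)))

C₂ : ℕ → ℕ → ℕ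
C₂ a b = (a C b) % 2

C₂<2 : ∀ a b → C₂ a b < 2
C₂<2 a b = m%n<n (a C b) 2

C₂%2≡C₂ : ∀ a b → C₂ a b % 2 ≡ C₂ a b
C₂%2≡C₂ a b = m%n%n≡m%n (a C b) 2

C₂-pascal : ∀ a b {u v} → C₂ a b ≡ u → C₂ a (suc b) ≡ v →
            C₂ (suc a) (suc b) ≡ (u + v) % 2
C₂-pascal a b refl refl = trans (cong (_% 2) (sym (nCk+nC[k+1]≡[n+1]C[k+1] a b)))
                                (%-distribˡ-+ (a C b) (a C suc b) 2)

mutual
  C₂-even-even : ∀ a b → C₂ (double a) (double b) ≡ C₂ a b
  C₂-even-even zero    zero    = refl
  C₂-even-even zero    (suc b) = refl
  C₂-even-even (suc a) zero    = refl
  C₂-even-even (suc a) (suc b) =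
    trans (C₂-pascal (suc (double a)) (suc (double b)) (C₂-odd-odd a b) (C₂-odd-even a (suc b)))
          (sym (C₂-pascal a b refl refl))

  C₂-even-odd : ∀ a b → C₂ (double a) (suc (double b)) ≡ 0
  C₂-even-odd zero    b = refl
  C₂-even-odd (suc a) b =
    trans (C₂-pascal (suc (double a)) (double b) (C₂-odd-even a b) (C₂-odd-odd a b))
          ([n+n]%2≡0 (C₂ a b))

  C₂-odd-even : ∀ a b → C₂ (suc (double a)) (double b) ≡ C₂ a b
  C₂-odd-even a       zero    = refl
  C₂-odd-even zero    (suc b) = refl
  C₂-odd-even (suc a) (suc b) =
    trans (C₂-pascal (double (suc a)) (suc (double b))
                     (C₂-even-odd (suc a) b) (C₂-even-even (suc a) (suc b)))
          (C₂%2≡C₂ (suc a) (suc b))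

  C₂-odd-odd : ∀ a b → C₂ (suc (double a)) (suc (double b)) ≡ C₂ a b
  C₂-odd-odd zero    zero    = refl
  C₂-odd-odd zero    (suc b) = refl
  C₂-odd-odd (suc a) b =
    trans (C₂-pascal (double (suc a)) (double b) (C₂-even-even (suc a) b) (C₂-even-odd (suc a) b))
          (trans (cong (_% 2) (+-identityʳ (C₂ (suc a) b))) (C₂%2≡C₂ (suc a) b))

lucas₂ : ∀ a b {r s} → r < 2 → s < 2 → C₂ (double a + r) (double b + s) ≡ C₂ a b * C₂ r s
lucas₂ a b (s≤s z≤n) (s≤s z≤n)
  rewrite +-identityʳ (double a) | +-identityʳ (double b) | *-identityʳ (C₂ a b)
  = C₂-even-even a b
lucas₂ a b (s≤s z≤n) (s≤s (s≤s z≤n))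
  rewrite +-identityʳ (double a) | +-comm (double b) 1 | *-zeroʳ (C₂ a b)
  = C₂-even-odd a b
lucas₂ a b (s≤s (s≤s z≤n)) (s≤s z≤n)
  rewrite +-comm (double a) 1 | +-identityʳ (double b) | *-identityʳ (C₂ a b)
  = C₂-odd-even a b
lucas₂ a b (s≤s (s≤s z≤n)) (s≤s (s≤s z≤n))
  rewrite +-comm (double a) 1 | +-comm (double b) 1 | *-identityʳ (C₂ a b)
  = C₂-odd-odd a b

lucas₂-carry : ∀ a b A B →
  C₂ (double a + A) (double b + B) ≡ C₂ (a + A / 2) (b + B / 2) * C₂ (A % 2) (B % 2)
lucas₂-carry a b A B = trans (cong₂ C₂ (carry a A) (carry b B))
                             (lucas₂ (a + A / 2) (b + B / 2) (m%n<n A 2) (m%n<n B 2))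
  where
  carry : ∀ m M → double m + M ≡ double (m + M / 2) + M % 2
  carry m M = begin
    double m + M                        ≡⟨ cong (double m +_) (n≡double[n/2]+n%2 M) ⟩
    double m + (double (M / 2) + M % 2) ≡⟨ +-assoc (double m) _ _ ⟨
    double m + double (M / 2) + M % 2   ≡⟨ cong (_+ M % 2) (double-distrib-+ m (M / 2)) ⟨
    double (m + M / 2) + M % 2          ∎
    where open ≡-Reasoning

sumBelow : ℕ → (ℕ → ℕ) → ℕ
sumBelow zero    f = 0
sumBelow (suc N) f = f 0 + sumBelow N (f ∘ suc)

sumBelow-cong : ∀ N {f g} → (∀ k → f k ≡ g k) → sumBelow N f ≡ sumBelow N g
sumBelow-cong zero    f≗g = refl
sumBelow-cong (suc N) f≗g = cong₂ _+_ (f≗g 0) (sumBelow-cong N (f≗g ∘ suc))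

sumBelow-+ : ∀ N f g → sumBelow N (λ k → f k + g k) ≡ sumBelow N f + sumBelow N g
sumBelow-+ zero    f g = refl
sumBelow-+ (suc N) f g = trans (cong (f 0 + g 0 +_) (sumBelow-+ N (f ∘ suc) (g ∘ suc)))
                               (interchange (f 0) (g 0) _ _)

sumBelow-*ˡ : ∀ N a f → sumBelow N (λ k → a * f k) ≡ a * sumBelow N f
sumBelow-*ˡ zero    a f = sym (*-zeroʳ a)
sumBelow-*ˡ (suc N) a f = trans (cong (a * f 0 +_) (sumBelow-*ˡ N a (f ∘ suc)))
                                (sym (*-distribˡ-+ a (f 0) _))

sumBelow-pairs : ∀ N f →
  sumBelow (double N) f ≡ sumBelow N (λ k → f (double k) + f (suc (double k)))
sumBelow-pairs zero    f = refl
sumBelow-pairs (suc N) f = trans (sym (+-assoc (f 0) (f 1) _))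
                                 (cong (f 0 + f 1 +_) (sumBelow-pairs N (f ∘ suc ∘ suc)))

sumBelow-vanishing : ∀ {N M} f → (∀ k → N ≤ k → f k ≡ 0) → N ≤ M →
                     sumBelow M f ≡ sumBelow N f
sumBelow-vanishing {zero}  {zero}  f f≡0 _         = refl
sumBelow-vanishing {zero}  {suc M} f f≡0 _         =
  cong₂ _+_ (f≡0 0 z≤n)
            (sumBelow-vanishing {M = M} (f ∘ suc) (λ k _ → f≡0 (suc k) z≤n) z≤n)
sumBelow-vanishing {suc N} {suc M} f f≡0 (s≤s N≤M) =
  cong (f 0 +_) (sumBelow-vanishing (f ∘ suc) (λ k N≤k → f≡0 (suc k) (s≤s N≤k)) N≤M)

sum-map-applyUpTo : ∀ (F h : ℕ → ℕ) N → sum (map F (applyUpTo h N)) ≡ sumBelow N (F ∘ h)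
sum-map-applyUpTo F h zero    = refl
sum-map-applyUpTo F h (suc N) = cong (F (h 0) +_) (sum-map-applyUpTo F (h ∘ suc) N)

term : ℕ → ℕ → ℕ → ℕ → ℕ
term p q n k = C₂ (6 * k + p) (n + 3 * k + q) * C₂ n k

shiftedT : ℕ → ℕ → ℕ → ℕ
shiftedT p q n = sumBelow (suc n) (term p q n)

carryˡ : ℕ → ℕ → ℕ
carryˡ p y = (6 * y + p) / 2

carryʳ : ℕ → ℕ → ℕ → ℕ
carryʳ q x y = (x + 3 * y + q) / 2

weight : ℕ → ℕ → ℕ → ℕ → ℕ
weight p q x y = C₂ ((6 * y + p) % 2) ((x + 3 * y + q) % 2) * C₂ x y

carryStep : (ℕ → ℕ → ℕ) → ℕ → ℕ → ℕ → ℕ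
carryStep F p q x = weight p q x 0 * F (carryˡ p 0) (carryʳ q x 0)
                  + weight p q x 1 * F (carryˡ p 1) (carryʳ q x 1)

carryStep-cong : ∀ {F G} → (∀ p q → F p q ≡ G p q) →
                 ∀ p q x → carryStep F p q x ≡ carryStep G p q x
carryStep-cong F≗G p q x =
  cong₂ _+_ (cong (weight p q x 0 *_) (F≗G (carryˡ p 0) (carryʳ q x 0)))
            (cong (weight p q x 1 *_) (F≗G (carryˡ p 1) (carryʳ q x 1)))

weight<2 : ∀ p q x y → weight p q x y < 2
weight<2 p q x y = bit*bit<2 (C₂<2 ((6 * y + p) % 2) ((x + 3 * y + q) % 2)) (C₂<2 x y)

term-vanishes : ∀ p q {n k} → n < k → term p q n k ≡ 0
term-vanishes p q {n} {k} n<k =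
  trans (cong (upper *_) (cong (_% 2) (k>n⇒nCk≡0 n<k))) (*-zeroʳ upper)
  where
  upper = C₂ (6 * k + p) (n + 3 * k + q)

term-split : ∀ p q n k {x y} → x < 2 → y < 2 →
  term p q (double n + x) (double k + y) ≡ weight p q x y * term (carryˡ p y) (carryʳ q x y) n k
term-split p q n k {x} {y} x<2 y<2 = begin
    C₂ (6 * (double k + y) + p) (double n + x + 3 * (double k + y) + q) * C₂ (double n + x) (double k + y)
  ≡⟨ cong₂ (λ u v → C₂ u v * C₂ (double n + x) (double k + y)) upper lower ⟩
    C₂ (double (6 * k) + P) (double (n + 3 * k) + Q) * C₂ (double n + x) (double k + y)
  ≡⟨ cong₂ _*_ (lucas₂-carry (6 * k) (n + 3 * k) P Q) (lucas₂ n k x<2 y<2) ⟩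
    (C₂ (6 * k + P / 2) (n + 3 * k + Q / 2) * C₂ (P % 2) (Q % 2)) * (C₂ n k * C₂ x y)
  ≡⟨ regroup (C₂ (6 * k + P / 2) (n + 3 * k + Q / 2)) (C₂ (P % 2) (Q % 2)) (C₂ n k) (C₂ x y) ⟩
    (C₂ (P % 2) (Q % 2) * C₂ x y) * (C₂ (6 * k + P / 2) (n + 3 * k + Q / 2) * C₂ n k)
  ∎
  where
  open ≡-Reasoning
  P = 6 * y + p
  Q = x + 3 * y + q
  regroup : ∀ a b c d → (a * b) * (c * d) ≡ (b * d) * (a * c)
  regroup = solve-∀
  upper-2* : ∀ k y p → 6 * (2 * k + y) + p ≡ 2 * (6 * k) + (6 * y + p)
  upper-2* = solve-∀
  lower-2* : ∀ n k x y q → 2 * n + x + 3 * (2 * k + y) + q ≡ 2 * (n + 3 * k) + (x + 3 * y + q)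
  lower-2* = solve-∀
  upper : 6 * (double k + y) + p ≡ double (6 * k) + P
  upper rewrite double≡2* k | double≡2* (6 * k) = upper-2* k y p
  lower : double n + x + 3 * (double k + y) + q ≡ double (n + 3 * k) + Q
  lower rewrite double≡2* n | double≡2* k | double≡2* (n + 3 * k) = lower-2* n k x y q

shiftedT-zero : ∀ p q → shiftedT p q 0 ≡ C₂ p q
shiftedT-zero p q = trans (+-identityʳ _) (*-identityʳ (C₂ p q))

shiftedT-split : ∀ p q n {x} → x < 2 →
  shiftedT p q (double n + x) ≡ carryStep (λ p′ q′ → shiftedT p′ q′ n) p q x
shiftedT-split p q n {x} x<2 = begin
    sumBelow (suc (double n + x)) f
  ≡⟨ sumBelow-vanishing f (λ k → term-vanishes p q) range ⟨
    sumBelow (double (suc n)) f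
  ≡⟨ sumBelow-pairs (suc n) f ⟩
    sumBelow (suc n) (λ k → f (double k) + f (suc (double k)))
  ≡⟨ sumBelow-cong (suc n) split ⟩
    sumBelow (suc n) (λ k → w₀ * t₀ k + w₁ * t₁ k)
  ≡⟨ sumBelow-+ (suc n) (λ k → w₀ * t₀ k) (λ k → w₁ * t₁ k) ⟩
    sumBelow (suc n) (λ k → w₀ * t₀ k) + sumBelow (suc n) (λ k → w₁ * t₁ k)
  ≡⟨ cong₂ _+_ (sumBelow-*ˡ (suc n) w₀ t₀) (sumBelow-*ˡ (suc n) w₁ t₁) ⟩
    w₀ * sumBelow (suc n) t₀ + w₁ * sumBelow (suc n) t₁
  ∎
  where
  open ≡-Reasoning
  f = term p q (double n + x)
  w₀ = weight p q x 0
  w₁ = weight p q x 1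
  t₀ = term (carryˡ p 0) (carryʳ q x 0) n
  t₁ = term (carryˡ p 1) (carryʳ q x 1) n
  range : suc (double n + x) ≤ double (suc n)
  range = s≤s (≤-trans (+-monoʳ-≤ (double n) (s≤s⁻¹ x<2)) (≤-reflexive (+-comm (double n) 1)))
  split : ∀ k → f (double k) + f (suc (double k)) ≡ w₀ * t₀ k + w₁ * t₁ k
  split k = cong₂ _+_
    (trans (cong f (sym (+-identityʳ (double k)))) (term-split p q n k x<2 (s≤s z≤n)))
    (trans (cong f (+-comm 1 (double k))) (term-split p q n k x<2 (s≤s (s≤s z≤n))))

-- a * x + b * y for bits a and b, by cases so that it computes on closed bits
bitComb : ℕ → ℕ → ℕ → ℕ → ℕ
bitComb zero    x zero    y = 0
bitComb zero    x (suc _) y = y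
bitComb (suc _) x zero    y = x
bitComb (suc _) x (suc _) y = x + y

bitComb≡ : ∀ {a b} x y → a < 2 → b < 2 → bitComb a x b y ≡ a * x + b * y
bitComb≡ x y (s≤s z≤n)       (s≤s z≤n)       = refl
bitComb≡ x y (s≤s z≤n)       (s≤s (s≤s z≤n)) = sym (+-identityʳ y)
bitComb≡ x y (s≤s (s≤s z≤n)) (s≤s z≤n)       = sym (trans (+-identityʳ _) (+-identityʳ x))
bitComb≡ x y (s≤s (s≤s z≤n)) (s≤s (s≤s z≤n)) = sym (cong₂ _+_ (+-identityʳ x) (+-identityʳ y))

-- Like runsAux, every digit other than 1 is read as 0.
mutual
  evalDigits : ℕ → ℕ → List ℕ → ℕ
  evalDigits p q []       = C₂ p q
  evalDigits p q (1 ∷ ds) = evalDigit p q 1 ds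
  evalDigits p q (_ ∷ ds) = evalDigit p q 0 ds

  evalDigit : ℕ → ℕ → ℕ → List ℕ → ℕ
  evalDigit p q x ds =
    bitComb (weight p q x 0) (evalDigits (carryˡ p 0) (carryʳ q x 0) ds)
            (weight p q x 1) (evalDigits (carryˡ p 1) (carryʳ q x 1) ds)

evalDigits-∷ : ∀ p q {x} ds → x < 2 →
  evalDigits p q (x ∷ ds) ≡ carryStep (λ p′ q′ → evalDigits p′ q′ ds) p q x
evalDigits-∷ p q ds (s≤s z≤n)       = bitComb≡ _ _ (weight<2 p q 0 0) (weight<2 p q 0 1)
evalDigits-∷ p q ds (s≤s (s≤s z≤n)) = bitComb≡ _ _ (weight<2 p q 1 0) (weight<2 p q 1 1)

shiftedT≡evalDigits : ∀ f n → n ≤ f → ∀ p q → shiftedT p q n ≡ evalDigits p q (bitsAux f n)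
shiftedT≡evalDigits zero    zero    _         p q = shiftedT-zero p q
shiftedT≡evalDigits (suc f) zero    _         p q = shiftedT-zero p q
shiftedT≡evalDigits (suc f) (suc m) (s≤s m≤f) p q = begin
    shiftedT p q (suc m)                            ≡⟨ cong (shiftedT p q) (n≡double[n/2]+n%2 (suc m)) ⟩
    shiftedT p q (double h + r)                     ≡⟨ shiftedT-split p q h r<2 ⟩
    carryStep (λ p′ q′ → shiftedT p′ q′ h) p q r    ≡⟨ carryStep-cong IH p q r ⟩
    carryStep (λ p′ q′ → evalDigits p′ q′ ds) p q r ≡⟨ evalDigits-∷ p q ds r<2 ⟨
    evalDigits p q (r ∷ ds)                         ∎
  where
  open ≡-Reasoning
  h = suc m / 2
  r = suc m % 2
  ds = bitsAux f h
  r<2 : r < 2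
  r<2 = m%n<n (suc m) 2
  IH : ∀ p q → shiftedT p q h ≡ evalDigits p q ds
  IH = shiftedT≡evalDigits f h (≤-trans (s≤s⁻¹ (m/n<m (suc m) 2 (s≤s (s≤s z≤n)))) m≤f)

S-even : ∀ j → S (double j) ≡ 1
S-even zero    = refl
S-even (suc j) = cong₂ _+_ (S-even j) (double%2≡0 j)

S-odd : ∀ j → S (suc (double j)) ≡ suc j
S-odd zero    = refl
S-odd (suc j) = trans (cong₂ _+_ (S-odd j) odd%2) (+-comm (suc j) 1)
  where
  odd%2 : suc (double j) % 2 ≡ 1
  odd%2 = trans (%-distribˡ-+ 1 (double j) 2) (cong (λ r → (1 + r) % 2) (double%2≡0 j))

runProduct : ℕ → List ℕ → ℕ
runProduct c ds = product (map S (runsAux c ds))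

evalDigits-0-1 : ∀ ds → evalDigits 0 1 ds ≡ 0
evalDigits-0-1 []                 = refl
evalDigits-0-1 (zero ∷ ds)        = refl
evalDigits-0-1 (suc zero ∷ ds)    = evalDigits-0-1 ds
evalDigits-0-1 (suc (suc _) ∷ ds) = refl

evalDigits-1-1 : ∀ ds → evalDigits 1 1 ds ≡ evalDigits 0 0 ds
evalDigits-1-1 []                 = refl
evalDigits-1-1 (zero ∷ ds)        = refl
evalDigits-1-1 (suc zero ∷ ds)    = cong (_+ evalDigits 3 2 ds) (evalDigits-0-1 ds)
evalDigits-1-1 (suc (suc _) ∷ ds) = refl

-- Inside a run of 1's of length l the value is carried by two states: (3,2) + j·(2,2)
-- when l = 2j+1, and (0,0) + (j+1)·(4,3) when l = 2j+2; the run's 0 turns it into S(l)·(0,0).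
mutual
  evalDigits-0-0 : ∀ ds → evalDigits 0 0 ds ≡ runProduct 0 ds
  evalDigits-0-0 []                 = refl
  evalDigits-0-0 (zero ∷ ds)        = evalDigits-0-0 ds
  evalDigits-0-0 (suc zero ∷ ds)    = trans (sym (+-identityʳ _)) (evalDigits-odd-run 0 ds)
  evalDigits-0-0 (suc (suc _) ∷ ds) = evalDigits-0-0 ds

  evalDigits-odd-run : ∀ j ds →
    evalDigits 3 2 ds + j * evalDigits 2 2 ds ≡ runProduct (suc (double j)) ds
  evalDigits-odd-run j []                 =
    trans (cong suc (*-identityʳ j)) (sym (trans (*-identityʳ _) (S-odd j)))
  evalDigits-odd-run j (zero ∷ ds)        = odd-run-closes j ds
  evalDigits-odd-run j (suc zero ∷ ds)    = begin
      (evalDigits 1 1 ds + evalDigits 4 3 ds) + j * evalDigits 4 3 ds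
    ≡⟨ +-assoc (evalDigits 1 1 ds) _ _ ⟩
      evalDigits 1 1 ds + suc j * evalDigits 4 3 ds
    ≡⟨ cong (_+ suc j * evalDigits 4 3 ds) (evalDigits-1-1 ds) ⟩
      evalDigits 0 0 ds + suc j * evalDigits 4 3 ds
    ≡⟨ evalDigits-even-run j ds ⟩
      runProduct (suc (suc (double j))) ds
    ∎
    where open ≡-Reasoning
  evalDigits-odd-run j (suc (suc _) ∷ ds) = odd-run-closes j ds

  odd-run-closes : ∀ j ds → suc j * evalDigits 1 1 ds ≡ S (suc (double j)) * runProduct 0 ds
  odd-run-closes j ds = trans (cong (suc j *_) (trans (evalDigits-1-1 ds) (evalDigits-0-0 ds)))
                           (cong (_* runProduct 0 ds) (sym (S-odd j)))

  evalDigits-even-run : ∀ j ds →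
    evalDigits 0 0 ds + suc j * evalDigits 4 3 ds ≡ runProduct (suc (suc (double j))) ds
  evalDigits-even-run j []                 =
    trans (cong suc (*-zeroʳ j)) (sym (trans (*-identityʳ _) (S-even (suc j))))
  evalDigits-even-run j (zero ∷ ds)        = even-run-closes j ds
  evalDigits-even-run j (suc zero ∷ ds)    = evalDigits-odd-run (suc j) ds
  evalDigits-even-run j (suc (suc _) ∷ ds) = even-run-closes j ds

  even-run-closes : ∀ j ds → evalDigits 0 0 ds + suc j * 0 ≡ S (double (suc j)) * runProduct 0 ds
  even-run-closes j ds = begin
    evalDigits 0 0 ds + suc j * 0        ≡⟨ cong (evalDigits 0 0 ds +_) (*-zeroʳ (suc j)) ⟩
    evalDigits 0 0 ds + 0                ≡⟨ +-identityʳ _ ⟩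
    evalDigits 0 0 ds                    ≡⟨ evalDigits-0-0 ds ⟩
    runProduct 0 ds                      ≡⟨ *-identityˡ _ ⟨
    1 * runProduct 0 ds                  ≡⟨ cong (_* runProduct 0 ds) (S-even (suc j)) ⟨
    S (double (suc j)) * runProduct 0 ds ∎
    where open ≡-Reasoning

T≡shiftedT : ∀ n → T n ≡ shiftedT 0 0 n
T≡shiftedT n = trans (sum-map-applyUpTo _ (λ k → k) (suc n)) (sumBelow-cong (suc n) summand)
  where
  summand : ∀ k → (((6 * k) C (n + 3 * k)) * (n C k)) % 2 ≡ term 0 0 n k
  summand k =
    trans ([m*n]%2≡m%2*n%2 ((6 * k) C (n + 3 * k)) (n C k))
          (cong (_* C₂ n k) (sym (cong₂ C₂ (+-identityʳ (6 * k)) (+-identityʳ (n + 3 * k)))))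

theorem14 : (n : ℕ) → T n ≡ runLengthTransform S n
theorem14 n = begin
  T n                          ≡⟨ T≡shiftedT n ⟩
  shiftedT 0 0 n               ≡⟨ shiftedT≡evalDigits n n ≤-refl 0 0 ⟩
  evalDigits 0 0 (bits n)      ≡⟨ evalDigits-0-0 (bits n) ⟩
  runLengthTransform S n       ∎
  where open ≡-Reasoning
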